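{- Let $F$ be a polynomial invariant of finite graphs such that $F(G_1+G_2)=F(G_1)F(G_2)$ for all nonempty graphs $G_1,G_2$. Suppose that for every graph $G$ and all pairwise distinct vertices $u,v,w$ of $G$ we have $F(G-u-v)=F(G-v-w)$. Then $F$ is trivial, i.e. $F(G)=F(K_1)^{\#V(G)}$ for every nonempty graph $G$.
   Context: Graphs are finite triples $G=(V,E,\varphi)$ with loops and multiple edges allowed, $\varphi$ mapping each edge to an unordered pair of (possibly equal) vertices. A polynomial invariant is a function assigning to each finite graph a polynomial (element of a fixed polynomial ring), with isomorphic graphs receiving equal values. $G_1+G_2$ is the disjoint union. $K_1$ is the graph with one vertex and no edges. $G-u$ deletes vertex $u$ and all edges incident with it; $G-u-v$ deletes $u$ and $v$ and all incident edges. -}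

module Defs where

open import Level using (Level; _⊔_)
open import Data.Nat using (ℕ; zero; suc; _+_; _≤_)
open import Data.Fin using (Fin; _↑ˡ_; _↑ʳ_; punchOut; _≟_)
open import Data.Product using (_×_; _,_; proj₁; proj₂)
open import Data.Sum using (_⊎_)
open import Data.List using (List; []; _∷_; _++_; map; length; lookup)
open import Data.Maybe using (Maybe; just; nothing)
open import Relation.Nullary using (yes; no; ¬_)
open import Relation.Binary.PropositionalEquality using (_≡_; _≢_)
open import Function.Bundles using (_↔_; Inverse)
open import Algebra.Bundles using (CommutativeRing; Semiring)
import Algebra.Definitions.RawSemiring as RawSemiringDefs

-- A finite multigraph (loops and multiple edges allowed).  The orientation of the pair is irrelevant: isomorphism
-- (below) identifies (a , b) with (b , a), so endpoints are unordered.
record Graph : Set where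
  constructor graph
  field
    order : ℕ
    edges : List (Fin order × Fin order)

open Graph public

record _≅_ (G H : Graph) : Set where
  field
    vmap : Fin (order G) ↔ Fin (order H)
    emap : Fin (length (edges G)) ↔ Fin (length (edges H))
    resp : ∀ e →
      let σ = Inverse.to vmap
          a = proj₁ (lookup (edges G) e)
          b = proj₂ (lookup (edges G) e)
      in (lookup (edges H) (Inverse.to emap e) ≡ (σ a , σ b))
         ⊎ (lookup (edges H) (Inverse.to emap e) ≡ (σ b , σ a))

K₁ : Graph
K₁ = graph 1 []

_⊕_ : Graph → Graph → Graph
graph m es ⊕ graph n fs =
  graph (m + n)
        (map (λ { (a , b) → (a ↑ˡ n , b ↑ˡ n) }) es
         ++ map (λ { (a , b) → (m ↑ʳ a , m ↑ʳ b) }) fs)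

Nonempty : Graph → Set
Nonempty G = 1 ≤ order G

delEdges : ∀ {k} (u : Fin (suc k)) →
           List (Fin (suc k) × Fin (suc k)) → List (Fin k × Fin k)
delEdges u [] = []
delEdges u ((a , b) ∷ es) with u ≟ a | u ≟ b
... | yes _   | _       = delEdges u es
... | no _    | yes _   = delEdges u es
... | no u≢a  | no u≢b  = (punchOut u≢a , punchOut u≢b) ∷ delEdges u es

_─_ : (G : Graph) → Fin (order G) → Graph
graph zero es ─ ()
graph (suc k) es ─ u = graph k (delEdges u es)

survivor : (G : Graph) (u v : Fin (order G)) → u ≢ v → Fin (order (G ─ u))
survivor (graph zero es) () v p
survivor (graph (suc k) es) u v p = punchOut p

_─_─_⟨_⟩ : (G : Graph) (u v : Fin (order G)) → u ≢ v → Graph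
G ─ u ─ v ⟨ p ⟩ = (G ─ u) ─ survivor G u v p

module _ {c ℓ : Level} (R : CommutativeRing c ℓ) where
  open CommutativeRing R using (Carrier; semiring)
  open Semiring semiring using (rawSemiring)
  pow : Carrier → ℕ → Carrier
  pow = RawSemiringDefs._^_ rawSemiring

IsInvariant : ∀ {c ℓ} (R : CommutativeRing c ℓ) →
              (Graph → CommutativeRing.Carrier R) → Set ℓ
IsInvariant R F = ∀ G H → G ≅ H → CommutativeRing._≈_ R (F G) (F H)

-- Pad G with two isolated vertices 0 and 1 in front, so that the first vertex v of G
-- becomes 2.  Deleting 1 and 0 gives back G, while deleting 0 and 2 leaves K₁ + (G - v);
-- the hypothesis equates the two, so by multiplicativity F(G) = F(K₁) F(G - v), and
-- induction on the order finishes.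
module Submission where

open import Defs
open import Algebra.Bundles using (CommutativeRing)
open import Function using (_∘_)
open import Data.Nat using (zero; suc; s≤s; z≤n)
open import Data.Fin using (Fin; zero; suc; _↑ʳ_)
open import Data.Fin.Properties using (_≟_; punchOut-cong)
open import Data.Product using (_×_; _,_)
open import Data.List using (List; []; _∷_; map)
open import Relation.Nullary using (yes; no)
open import Relation.Binary.PropositionalEquality
  using (_≡_; _≢_; refl; cong; cong₂; sym; module ≡-Reasoning)

sucEdges : ∀ {n} → List (Fin n × Fin n) → List (Fin (suc n) × Fin (suc n))
sucEdges = map λ { (a , b) → (suc a , suc b) }

delEdges-zero-sucEdges : ∀ {n} (es : List (Fin n × Fin n)) →
                         delEdges zero (sucEdges es) ≡ es
delEdges-zero-sucEdges []       = refl
delEdges-zero-sucEdges (e ∷ es) = cong (e ∷_) (delEdges-zero-sucEdges es)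

delEdges-suc-sucEdges : ∀ {n} (x : Fin (suc n)) (es : List (Fin (suc n) × Fin (suc n))) →
                        delEdges (suc x) (sucEdges es) ≡ sucEdges (delEdges x es)
delEdges-suc-sucEdges x [] = refl
delEdges-suc-sucEdges x ((a , b) ∷ es) with x ≟ a | x ≟ b
... | yes _ | _     = delEdges-suc-sucEdges x es
... | no _  | yes _ = delEdges-suc-sucEdges x es
... | no _  | no _  =
  cong₂ _∷_ (cong₂ _,_ (cong suc (punchOut-cong x refl)) (cong suc (punchOut-cong x refl)))
            (delEdges-suc-sucEdges x es)

K₁⊕graph≡graph-sucEdges : ∀ k (es : List (Fin k × Fin k)) →
                          K₁ ⊕ graph k es ≡ graph (suc k) (sucEdges es)
K₁⊕graph≡graph-sucEdges k es = cong (graph (suc k)) (map-↑ʳ≡sucEdges es)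
  where
  map-↑ʳ≡sucEdges : (es : List (Fin k × Fin k)) →
                    map (λ { (a , b) → (1 ↑ʳ a , 1 ↑ʳ b) }) es ≡ sucEdges es
  map-↑ʳ≡sucEdges []       = refl
  map-↑ʳ≡sucEdges (e ∷ es) = cong (_ ∷_) (map-↑ʳ≡sucEdges es)

edges-Fin0≡[] : (es : List (Fin 0 × Fin 0)) → es ≡ []
edges-Fin0≡[] []             = refl
edges-Fin0≡[] ((() , _) ∷ _)

pad₂ : Graph → Graph
pad₂ (graph n es) = graph (suc (suc n)) (sucEdges (sucEdges es))

pad₂─1─0≡ : ∀ G → pad₂ G ─ suc zero ─ zero ⟨ (λ ()) ⟩ ≡ G
pad₂─1─0≡ (graph n es) = cong (graph n) (begin
    delEdges zero (delEdges (suc zero) (sucEdges (sucEdges es)))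
      ≡⟨ cong (delEdges zero) (delEdges-suc-sucEdges zero (sucEdges es)) ⟩
    delEdges zero (sucEdges (delEdges zero (sucEdges es)))
      ≡⟨ delEdges-zero-sucEdges _ ⟩
    delEdges zero (sucEdges es)
      ≡⟨ delEdges-zero-sucEdges es ⟩
    es ∎)
  where open ≡-Reasoning

pad₂─0─2≡K₁⊕─0 : ∀ k (es : List (Fin (suc k) × Fin (suc k))) →
                 pad₂ (graph (suc k) es) ─ zero ─ suc (suc zero) ⟨ (λ ()) ⟩
                   ≡ K₁ ⊕ (graph (suc k) es ─ zero)
pad₂─0─2≡K₁⊕─0 k es = begin
    graph (suc k) (delEdges (suc zero) (delEdges zero (sucEdges (sucEdges es))))
      ≡⟨ cong (graph (suc k) ∘ delEdges (suc zero)) (delEdges-zero-sucEdges (sucEdges es)) ⟩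
    graph (suc k) (delEdges (suc zero) (sucEdges es))
      ≡⟨ cong (graph (suc k)) (delEdges-suc-sucEdges zero es) ⟩
    graph (suc k) (sucEdges (delEdges zero es))
      ≡⟨ sym (K₁⊕graph≡graph-sucEdges k (delEdges zero es)) ⟩
    K₁ ⊕ graph k (delEdges zero es) ∎
  where open ≡-Reasoning

module _ {c ℓ} (R : CommutativeRing c ℓ) (F : Graph → CommutativeRing.Carrier R) where
  open CommutativeRing R using (_≈_; _*_; *-identityʳ; *-congˡ; setoid)
  open import Relation.Binary.Reasoning.Setoid setoid

  Multiplicative : Set _
  Multiplicative = ∀ G₁ G₂ → Nonempty G₁ → Nonempty G₂ → F (G₁ ⊕ G₂) ≈ F G₁ * F G₂

  RotatesDeletedPairs : Set _
  RotatesDeletedPairs = ∀ G (u v w : Fin (order G)) (uv : u ≢ v) (vw : v ≢ w) → u ≢ w →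
                          F (G ─ u ─ v ⟨ uv ⟩) ≈ F (G ─ v ─ w ⟨ vw ⟩)

  private
    F-cong : ∀ {G H} → G ≡ H → F G ≈ F H
    F-cong refl = CommutativeRing.refl R

  F-delete-first : RotatesDeletedPairs →
                   ∀ k (es : List (Fin (suc k) × Fin (suc k))) →
                   F (graph (suc k) es) ≈ F (K₁ ⊕ (graph (suc k) es ─ zero))
  F-delete-first hyp k es = begin
      F G                                             ≈⟨ F-cong (sym (pad₂─1─0≡ G)) ⟩
      F (pad₂ G ─ suc zero ─ zero ⟨ (λ ()) ⟩)         ≈⟨ hyp (pad₂ G) _ _ (suc (suc zero)) (λ ()) (λ ()) (λ ()) ⟩
      F (pad₂ G ─ zero ─ suc (suc zero) ⟨ (λ ()) ⟩)   ≈⟨ F-cong (pad₂─0─2≡K₁⊕─0 k es) ⟩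
      F (K₁ ⊕ (G ─ zero))                             ∎
    where G = graph (suc k) es

  F-trivial : Multiplicative → RotatesDeletedPairs →
              ∀ k (es : List (Fin (suc k) × Fin (suc k))) →
              F (graph (suc k) es) ≈ pow R (F K₁) (suc k)
  F-trivial mult hyp zero es = begin
      F (graph 1 es)                       ≈⟨ F-delete-first hyp zero es ⟩
      F (K₁ ⊕ graph 0 (delEdges zero es))  ≈⟨ F-cong (cong (λ fs → K₁ ⊕ graph 0 fs) (edges-Fin0≡[] _)) ⟩
      F K₁                                 ≈⟨ CommutativeRing.sym R (*-identityʳ _) ⟩
      pow R (F K₁) 1                       ∎
  F-trivial mult hyp (suc k) es = begin
      F G                             ≈⟨ F-delete-first hyp (suc k) es ⟩
      F (K₁ ⊕ (G ─ zero))             ≈⟨ mult K₁ (G ─ zero) (s≤s z≤n) (s≤s z≤n) ⟩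
      F K₁ * F (G ─ zero)             ≈⟨ *-congˡ (F-trivial mult hyp k (delEdges zero es)) ⟩
      pow R (F K₁) (suc (suc k))      ∎
    where G = graph (suc (suc k)) es

lemma3 : ∀ {c ℓ} (R : CommutativeRing c ℓ)
         (F : Graph → CommutativeRing.Carrier R) →
         IsInvariant R F →
         (∀ G₁ G₂ → Nonempty G₁ → Nonempty G₂ →
            CommutativeRing._≈_ R (F (G₁ ⊕ G₂)) (CommutativeRing._*_ R (F G₁) (F G₂))) →
         (∀ G (u v w : Fin (order G)) (uv : u ≢ v) (vw : v ≢ w) → u ≢ w →
            CommutativeRing._≈_ R (F (G ─ u ─ v ⟨ uv ⟩)) (F (G ─ v ─ w ⟨ vw ⟩))) →
         ∀ G → Nonempty G → CommutativeRing._≈_ R (F G) (pow R (F K₁) (order G))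
lemma3 R F _ mult hyp (graph (suc k) es) _ = F-trivial R F mult hyp k es
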